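{- Let $n$ be a positive integer, $a\in[n]$ and $U\subseteq[n]$. Then the lattice $\mathsf{S}(n,\langle a,U\rangle)$ is both isomorphic and dually isomorphic to $\mathsf{S}(n,\langle a,[n]\setminus U\rangle)$. In particular, each $\mathsf{S}(n,\langle a,U\rangle)$ is self-dual.
   Context: $[n]=\{1,\dots,n\}$. $\mathrm{Bip}(n)$ is the set of bipartitions of $[n]$, i.e. transitive relations $\mathbf{x}\subseteq[n]\times[n]$ whose complement in $[n]\times[n]$ is also transitive, ordered by inclusion; it is a lattice whose join is the transitive closure of the union and whose least element is $\varnothing$. $\mathsf{G}(n)$ is the set of all $([n]\setminus V)\times V$ with $\varnothing\neq V\subsetneq[n]$; for $W\subseteq[n]$, $\langle a,W\rangle=(\{a\}\cup([n]\setminus W))\times(\{a\}\cup W)$; $\mathsf{S}(n,\langle a,W\rangle)$ is the $(\vee,0)$-subsemilattice of $\mathrm{Bip}(n)$ generated by $\mathsf{G}(n)\cup\{\langle a,W\rangle\}$, ordered by inclusion (it is a finite lattice). -}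

module Defs where

open import Level using (0ℓ)
open import Data.Nat using (ℕ)
open import Data.Fin using (Fin)
open import Data.Fin.Subset using (Subset; _∈_; _∉_; Nonempty; ∁)
open import Data.Product using (Σ; ∃; _×_; _,_; proj₁)
open import Data.Sum using (_⊎_)
open import Data.Empty using (⊥)
open import Relation.Nullary using (¬_)
open import Relation.Binary.Core using (Rel)
open import Relation.Binary.PropositionalEquality using (_≡_)
open import Relation.Binary.Construct.Closure.Transitive using (TransClosure)
open import Function.Bundles using (_⇔_)

Relation : ℕ → Set₁
Relation n = Rel (Fin n) 0ℓ

_⊆ᵣ_ : ∀ {n} → Relation n → Relation n → Set
R ⊆ᵣ S = ∀ i j → R i j → S i j

∅ᵣ : ∀ {n} → Relation n
∅ᵣ _ _ = ⊥

_∨ᵣ_ : ∀ {n} → Relation n → Relation n → Relation n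
R ∨ᵣ S = TransClosure (λ i j → R i j ⊎ S i j)

IsBipartition : ∀ {n} → Relation n → Set
IsBipartition R =
  (∀ i j k → R i j → R j k → R i k) ×
  (∀ i j k → ¬ R i j → ¬ R j k → ¬ R i k)

gRel : ∀ {n} → Subset n → Relation n
gRel V i j = (i ∉ V) × (j ∈ V)

Proper : ∀ {n} → Subset n → Set
Proper V = ∃ λ x → x ∉ V

angle : ∀ {n} → Fin n → Subset n → Relation n
angle a W i j = (i ≡ a ⊎ i ∉ W) × (j ≡ a ⊎ j ∈ W)

-- Elements of the (∨,0)-subsemilattice of Bip(n) generated by G(n) ∪ {c}
data InS {n : ℕ} (c : Relation n) : Relation n → Set₁ where
  bot  : InS c ∅ᵣ
  genG : (V : Subset n) → Nonempty V → Proper V → InS c (gRel V)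
  genC : InS c c
  join : ∀ {R S} → InS c R → InS c S → InS c (R ∨ᵣ S)

S : (n : ℕ) → Relation n → Set₁
S n c = Σ (Relation n) (InS c)

_⊑_ : ∀ {n} {c : Relation n} → S n c → S n c → Set
x ⊑ y = proj₁ x ⊆ᵣ proj₁ y

_≈ₛ_ : ∀ {n} {c : Relation n} → S n c → S n c → Set
x ≈ₛ y = (x ⊑ y) × (y ⊑ x)

-- order (= lattice) isomorphism: order-preserving and reflecting, surjective
Isomorphic : ∀ {n} (c d : Relation n) → Set₁
Isomorphic {n} c d = Σ (S n c → S n d) λ f →
  (∀ x y → (x ⊑ y) ⇔ (f x ⊑ f y)) × (∀ z → ∃ λ x → f x ≈ₛ z)

DuallyIsomorphic : ∀ {n} (c d : Relation n) → Set₁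
DuallyIsomorphic {n} c d = Σ (S n c → S n d) λ f →
  (∀ x y → (x ⊑ y) ⇔ (f y ⊑ f x)) × (∀ z → ∃ λ x → f x ≈ₛ z)

SelfDual : ∀ {n} (c : Relation n) → Set₁
SelfDual c = DuallyIsomorphic c c

module Submission where

-- Transposition R ↦ Rᵀ maps cuts to cuts (([n]∖V)×V ↦ V×([n]∖V)),
-- commutes with joins and sends ⟨a,U⟩ to ⟨a,∁U⟩; so it maps S(n,⟨a,U⟩) onto
-- S(n,⟨a,∁U⟩), and it obviously preserves and reflects inclusion.
--
-- For x ∈ S(n,c), c = ⟨a,W⟩, d = ⟨a,W'⟩ with d = cᵀ, let F(x)
-- be the join of all cuts avoiding x together with d if d avoids x.  Then F(x) is
-- the greatest element of S(n,d) disjoint from x, and conversely x is the greatest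
-- element of S(n,c) disjoint from F(x) (a "polarity").  Two polarities in opposite
-- directions give a dual isomorphism.  Constructing F needs every element of
-- S(n,c) to be a decidable bipartition; the only non-obvious part of that is the
-- decidability of transitive closures, proved first by Warshall's algorithm.

open import Defs
open import Data.Nat using (ℕ; _<_)
open import Data.Fin using (Fin)
open import Data.Fin.Subset using (Subset; ∁)
open import Data.Product using (_×_)

open import Level using (0ℓ)
import Data.Nat as Nat
open import Data.Bool using (Bool; true)
open import Data.Empty using (⊥-elim)
open import Data.Fin using (zero; suc; _≟_)
open import Data.Fin.Properties using (all?)
open import Data.Fin.Subset using (_∈_; _∉_)
open import Data.Fin.Subset.Properties
  using (_∈?_; nonempty?; x∈∁p⇒x∉p; x∉∁p⇒x∈p; x∈p⇒x∉∁p; x∉p⇒x∈∁p)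
open import Data.List using (List; []; _∷_; allFin)
open import Data.List.Membership.Propositional using () renaming (_∈_ to _∈ₗ_)
open import Data.List.Membership.Propositional.Properties using (∈-allFin)
open import Data.List.Relation.Unary.Any using (here; there)
open import Data.Product using (Σ-syntax; _,_; proj₁; proj₂)
open import Data.Sum using (_⊎_; inj₁; inj₂; [_,_]′)
open import Data.Vec using (tabulate)
open import Data.Vec.Properties using ([]=⇒lookup; lookup⇒[]=; lookup∘tabulate)
open import Function using (_∘_)
open import Function.Bundles using (_⇔_; mk⇔; Equivalence)
open import Relation.Binary.Core using (Rel)
open import Relation.Binary.Definitions using (Decidable; Transitive)
open import Relation.Binary.Construct.Union using (_∪_)
open import Relation.Binary.Construct.Closure.Transitive using (TransClosure; [_]; _∷_; _++_)
open import Relation.Binary.PropositionalEquality using (_≡_; _≢_; refl; sym; trans; subst)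
open import Relation.Nullary using (¬_; Dec; yes; no)
open import Relation.Nullary.Decidable
  using (map′; _×-dec_; _⊎-dec_; ¬?; does; dec-true; decidable-stable)

open Equivalence using (to; from)

-- Warshall's algorithm: reachability along a decidable relation is decidable as
-- soon as the vertices can be listed.  `Via ks i j` is a path from i to j all of
-- whose intermediate vertices lie in ks; allowing one more intermediate vertex k
-- adds exactly the paths i ⇝ k ⇝ j.
module Reachability {A : Set} (R : Rel A 0ℓ) (R? : Decidable R) where

  data Via (ks : List A) : Rel A 0ℓ where
    edge    : ∀ {i j} → R i j → Via ks i j
    through : ∀ {i k j} → R i k → k ∈ₗ ks → Via ks k j → Via ks i j

  widen : ∀ {k ks i j} → Via ks i j → Via (k ∷ ks) i j
  widen (edge r)         = edge r
  widen (through r m p) = through r (there m) (widen p)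

  concat : ∀ {ks i k j} → Via ks i k → k ∈ₗ ks → Via ks k j → Via ks i j
  concat (edge r)         m q = through r m q
  concat (through r m′ p) m q = through r m′ (concat p m q)

  -- cut a path at its first and last visits of the new vertex k
  split : ∀ {k ks i j} → Via (k ∷ ks) i j → Via ks i j ⊎ (Via ks i k × Via ks k j)
  split (edge r) = inj₁ (edge r)
  split (through r (here refl) p) = inj₂ (edge r , [ (λ q → q) , proj₂ ]′ (split p))
  split (through r (there m) p) with split p
  ... | inj₁ q         = inj₁ (through r m q)
  ... | inj₂ (q₁ , q₂) = inj₂ (through r m q₁ , q₂)

  merge : ∀ {k ks i j} → Via ks i j ⊎ (Via ks i k × Via ks k j) → Via (k ∷ ks) i j
  merge (inj₁ p)       = widen p
  merge (inj₂ (p , q)) = concat (widen p) (here refl) (widen q)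

  via? : ∀ ks → Decidable (Via ks)
  via? []       i j = map′ edge (λ { (edge r) → r ; (through _ () _) }) (R? i j)
  via? (k ∷ ks) i j = map′ merge split (via? ks i j ⊎-dec (via? ks i k ×-dec via? ks k j))

  toClosure : ∀ {ks i j} → Via ks i j → TransClosure R i j
  toClosure (edge r)         = [ r ]
  toClosure (through r _ p) = r ∷ toClosure p

  fromClosure : ∀ {ks} → (∀ x → x ∈ₗ ks) → ∀ {i j} → TransClosure R i j → Via ks i j
  fromClosure all [ r ]                   = edge r
  fromClosure all (_∷_ {y = k} r p) = through r (all k) (fromClosure all p)

  closure? : (ks : List A) → (∀ x → x ∈ₗ ks) → Decidable (TransClosure R)
  closure? ks all i j = map′ toClosure (fromClosure all) (via? ks i j)

private
  variable
    n : ℕ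
    a : Fin n
    R T X Z : Relation n
    c d : Relation n

-- Disjointness is phrased as inclusion in the complement, so that the
-- facts about least upper bounds below also bound disjointness.
infix 30 _ᵀ _ᶜ
infix 4 _≐_

_ᵀ : Relation n → Relation n
(R ᵀ) i j = R j i

_ᶜ : Relation n → Relation n
(R ᶜ) i j = ¬ R i j

_≐_ : Relation n → Relation n → Set
R ≐ T = R ⊆ᵣ T × T ⊆ᵣ R

Disjoint : Relation n → Relation n → Set
Disjoint R T = R ⊆ᵣ T ᶜ

⊆-trans : R ⊆ᵣ T → T ⊆ᵣ Z → R ⊆ᵣ Z
⊆-trans R⊆T T⊆Z i j = T⊆Z i j ∘ R⊆T i j

≐-trans : R ≐ T → T ≐ Z → R ≐ Z
≐-trans (R⊆T , T⊆R) (T⊆Z , Z⊆T) = ⊆-trans R⊆T T⊆Z , ⊆-trans Z⊆T T⊆R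

ᵀ-cong : R ≐ T → R ᵀ ≐ T ᵀ
ᵀ-cong (R⊆T , T⊆R) = (λ i j → R⊆T j i) , (λ i j → T⊆R j i)

ᵀ-swap : d ≐ c ᵀ → c ≐ d ᵀ
ᵀ-swap (d⊆cᵀ , cᵀ⊆d) = (λ i j → cᵀ⊆d j i) , (λ i j → d⊆cᵀ j i)

disjoint-sym : Disjoint R T → Disjoint T R
disjoint-sym R∩T=∅ i j t r = R∩T=∅ i j r t

disjoint? : Decidable R → Decidable T → Dec (Disjoint R T)
disjoint? R? T? =
  map′ (λ h i j r t → h i j (r , t)) (λ h i j (r , t) → h i j r t)
       (all? λ i → all? λ j → ¬? (R? i j ×-dec T? i j))

subsetOf : {P : Fin n → Set} → (∀ k → Dec (P k)) → Subset n
subsetOf P? = tabulate (λ k → does (P? k))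

∈-subsetOf : {P : Fin n → Set} (P? : ∀ k → Dec (P k)) {k : Fin n} → k ∈ subsetOf P? ⇔ P k
∈-subsetOf {n} P? {k} = mk⇔
  (λ k∈ → witness (P? k) (trans (sym (lookup∘tabulate f k)) ([]=⇒lookup k∈)))
  (λ Pk → lookup⇒[]= k (subsetOf P?) (trans (lookup∘tabulate f k) (dec-true (P? k) Pk)))
  where
    f : Fin n → Bool
    f k = does (P? k)
    witness : {A : Set} (A? : Dec A) → does A? ≡ true → A
    witness (yes p) _ = p

∨-inl : R ⊆ᵣ (R ∨ᵣ T)
∨-inl i j r = [ inj₁ r ]

∨-inr : T ⊆ᵣ (R ∨ᵣ T)
∨-inr i j t = [ inj₂ t ]

∨-least : Transitive Z → R ⊆ᵣ Z → T ⊆ᵣ Z → (R ∨ᵣ T) ⊆ᵣ Z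
∨-least trZ R⊆Z T⊆Z i j [ s ]                = [ R⊆Z i j , T⊆Z i j ]′ s
∨-least trZ R⊆Z T⊆Z i j (_∷_ {y = k} s p) =
  trZ ([ R⊆Z i k , T⊆Z i k ]′ s) (∨-least trZ R⊆Z T⊆Z k j p)

∨-cong : R ≐ X → T ≐ Z → (R ∨ᵣ T) ≐ (X ∨ᵣ Z)
∨-cong (R⊆X , X⊆R) (T⊆Z , Z⊆T) =
  ∨-least _++_ (⊆-trans R⊆X ∨-inl) (⊆-trans T⊆Z ∨-inr) ,
  ∨-least _++_ (⊆-trans X⊆R ∨-inl) (⊆-trans Z⊆T ∨-inr)

∨-ᵀ⊆ : (R ᵀ ∨ᵣ T ᵀ) ⊆ᵣ (R ∨ᵣ T) ᵀ
∨-ᵀ⊆ = ∨-least (λ p q → q ++ p) (λ i j r → [ inj₁ r ]) (λ i j t → [ inj₂ t ])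

∨-ᵀ : (R ᵀ ∨ᵣ T ᵀ) ≐ (R ∨ᵣ T) ᵀ
∨-ᵀ = ∨-ᵀ⊆ , λ i j → ∨-ᵀ⊆ j i

record IsDecBip (X : Relation n) : Set where
  field
    decide       : Decidable X
    transitive   : Transitive X
    coTransitive : Transitive (X ᶜ)

∨-isDecBip : IsDecBip R → IsDecBip T → IsDecBip (R ∨ᵣ T)
∨-isDecBip {R = R} {T = T} bipR bipT = record
  { decide       = Reachability.closure? (R ∪ T) (λ i j → R.decide i j ⊎-dec T.decide i j)
                                         (allFin _) ∈-allFin
  ; transitive   = _++_
  ; coTransitive = coTransitive
  }
  where
    module R = IsDecBip bipR
    module T = IsDecBip bipT
    firstStep : ∀ {i j p} → ¬ (R ∨ᵣ T) i j → ¬ (R ∪ T) j p → ¬ (R ∪ T) i p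
    firstStep ¬ij ¬jp (inj₁ r) = R.coTransitive (¬ij ∘ ∨-inl _ _) (¬jp ∘ inj₁) r
    firstStep ¬ij ¬jp (inj₂ t) = T.coTransitive (¬ij ∘ ∨-inr _ _) (¬jp ∘ inj₂) t
    coTransitive : Transitive ((R ∨ᵣ T) ᶜ)
    coTransitive ¬ij ¬jk [ s ]      = firstStep ¬ij (¬jk ∘ [_]) s
    coTransitive ¬ij ¬jk (s ∷ rest) = firstStep ¬ij (λ s′ → ¬jk (s′ ∷ rest)) s

cut-isDecBip : (V : Subset n) → IsDecBip (gRel V)
cut-isDecBip V = record
  { decide       = λ i j → ¬? (i ∈? V) ×-dec (j ∈? V)
  ; transitive   = λ (_ , j∈V) (j∉V , _) → ⊥-elim (j∉V j∈V)
  ; coTransitive = coTransitive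
  }
  where
    coTransitive : Transitive (gRel V ᶜ)
    coTransitive {i} {j} {k} ¬ij ¬jk (i∉V , k∈V) with j ∈? V
    ... | yes j∈V = ¬ij (i∉V , j∈V)
    ... | no  j∉V = ¬jk (j∉V , k∈V)

cut-irreflexive : (V : Subset n) → ∀ {u v} → gRel V u v → u ≢ v
cut-irreflexive V (u∉V , u∈V) refl = u∉V u∈V

cut-ᵀ : (V : Subset n) → gRel (∁ V) ≐ gRel V ᵀ
cut-ᵀ V = (λ i j (i∉∁V , j∈∁V) → x∈∁p⇒x∉p j∈∁V , x∉∁p⇒x∈p i∉∁V)
        , (λ i j (j∉V , i∈V) → x∈p⇒x∉∁p i∈V , x∉p⇒x∈∁p j∉V)

angle-isDecBip : (a : Fin n) (W : Subset n) → IsDecBip (angle a W)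
angle-isDecBip a W = record
  { decide       = λ i j → ((i ≟ a) ⊎-dec ¬? (i ∈? W)) ×-dec ((j ≟ a) ⊎-dec (j ∈? W))
  ; transitive   = λ (ai , _) (_ , bk) → ai , bk
  ; coTransitive = coTransitive
  }
  where
    coTransitive : Transitive (angle a W ᶜ)
    coTransitive {i} {j} {k} ¬ij ¬jk (ai , bk) with j ∈? W
    ... | yes j∈W = ¬ij (ai , inj₂ j∈W)
    ... | no  j∉W = ¬jk (inj₂ j∉W , bk)

angle-loop : (W : Subset n) → ∀ {u} → angle a W u u → u ≡ a
angle-loop W (inj₁ u≡a , _)         = u≡a
angle-loop W (inj₂ _   , inj₁ u≡a) = u≡a
angle-loop W (inj₂ u∉W , inj₂ u∈W) = ⊥-elim (u∉W u∈W)

angle-apex : (W : Subset n) → angle a W a a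
angle-apex W = inj₁ refl , inj₁ refl

angle-hub : (W : Subset n) → ∀ {u v} → angle a W u v → angle a W u a × angle a W a v
angle-hub W (au , bv) = (au , inj₁ refl) , (inj₁ refl , bv)

angle-ᵀ : (a : Fin n) (W : Subset n) → angle a (∁ W) ≐ angle a W ᵀ
angle-ᵀ a W = (λ i j (ai , bj) → [ inj₁ , inj₂ ∘ x∈∁p⇒x∉p ]′ bj , [ inj₁ , inj₂ ∘ x∉∁p⇒x∈p ]′ ai)
            , (λ i j (aj , bi) → [ inj₁ , inj₂ ∘ x∈p⇒x∉∁p ]′ bi , [ inj₁ , inj₂ ∘ x∉p⇒x∈∁p ]′ aj)

⊥S : S n c
⊥S = ∅ᵣ , bot

_∨S_ : S n c → S n c → S n c
(R , R∈) ∨S (T , T∈) = (R ∨ᵣ T) , join R∈ T∈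

⋁ : ∀ {m} → (Fin m → S n c) → S n c
⋁ {m = Nat.zero}  f = ⊥S
⋁ {m = Nat.suc m} f = f zero ∨S ⋁ (f ∘ suc)

⋁-upper : ∀ {m} (f : Fin m → S n c) i → f i ⊑ ⋁ f
⋁-upper f zero    = ∨-inl
⋁-upper f (suc i) = ⊆-trans (⋁-upper (f ∘ suc) i) ∨-inr

⋁-least : ∀ {m} {f : Fin m → S n c} → Transitive Z → (∀ i → proj₁ (f i) ⊆ᵣ Z) → proj₁ (⋁ f) ⊆ᵣ Z
⋁-least {m = Nat.zero}  trZ f⊆Z _ _ ()
⋁-least {m = Nat.suc m} trZ f⊆Z = ∨-least trZ (f⊆Z zero) (⋁-least trZ (f⊆Z ∘ suc))

cutS : (V : Subset n) → Proper V → S n c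
cutS V proper with nonempty? V
... | yes nonempty = gRel V , genG V nonempty proper
... | no  _        = ⊥S

cutS-≐ : (V : Subset n) (proper : Proper V) → proj₁ (cutS {c = c} V proper) ≐ gRel V
cutS-≐ V proper with nonempty? V
... | yes _     = (λ _ _ g → g) , (λ _ _ g → g)
... | no  empty = (λ _ _ ()) , (λ i j (_ , j∈V) → ⊥-elim (empty (j , j∈V)))

InS-isDecBip : IsDecBip c → InS c X → IsDecBip X
InS-isDecBip bipC bot = record
  { decide = λ _ _ → no (λ ()) ; transitive = λ () ; coTransitive = λ _ _ () }
InS-isDecBip bipC (genG V _ _) = cut-isDecBip V
InS-isDecBip bipC genC         = bipC
InS-isDecBip bipC (join p q)   = ∨-isDecBip (InS-isDecBip bipC p) (InS-isDecBip bipC q)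

transposeS : d ≐ c ᵀ → InS c X → Σ[ y ∈ S n d ] proj₁ y ≐ X ᵀ
transposeS d≐cᵀ bot = ⊥S , (λ _ _ ()) , (λ _ _ ())
transposeS d≐cᵀ (genG V (x , x∈V) (y , y∉V)) =
  (gRel (∁ V) , genG (∁ V) (y , x∉p⇒x∈∁p y∉V) (x , x∈p⇒x∉∁p x∈V)) , cut-ᵀ V
transposeS d≐cᵀ genC = (_ , genC) , d≐cᵀ
transposeS d≐cᵀ (join p q) with transposeS d≐cᵀ p | transposeS d≐cᵀ q
... | y₁ , y₁≐ | y₂ , y₂≐ = (y₁ ∨S y₂) , ≐-trans (∨-cong y₁≐ y₂≐) ∨-ᵀ

transpose-iso : ∀ {n} {c d : Relation n} → d ≐ c ᵀ → Isomorphic c d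
transpose-iso {n} {c} {d} d≐cᵀ = f , order , onto
  where
    f : S n c → S n d
    f x = proj₁ (transposeS d≐cᵀ (proj₂ x))
    f≐ : (x : S n c) → proj₁ (f x) ≐ proj₁ x ᵀ
    f≐ x = proj₂ (transposeS d≐cᵀ (proj₂ x))
    order : ∀ x y → (x ⊑ y) ⇔ (f x ⊑ f y)
    order x y = mk⇔
      (λ x⊑y i j fxij → proj₂ (f≐ y) i j (x⊑y j i (proj₁ (f≐ x) i j fxij)))
      (λ fx⊑fy i j xij → proj₁ (f≐ y) j i (fx⊑fy j i (proj₂ (f≐ x) j i xij)))
    onto : ∀ z → Σ[ x ∈ S n c ] f x ≈ₛ z
    onto z = let (x , x≐zᵀ) = transposeS (ᵀ-swap d≐cᵀ) (proj₂ z)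
             in x , ≐-trans (f≐ x) (ᵀ-cong x≐zᵀ)

record Polarity {n : ℕ} (c d : Relation n) : Set₁ where
  field
    F          : S n c → S n d
    F-disjoint : ∀ x → Disjoint (proj₁ (F x)) (proj₁ x)
    F-greatest : ∀ x {Z} → InS d Z → Disjoint Z (proj₁ x) → Z ⊆ᵣ proj₁ (F x)
    F-reflects : ∀ y {G} → InS c G → Disjoint G (proj₁ (F y)) → G ⊆ᵣ proj₁ y

dual-iso : ∀ {n} {c d : Relation n} → Polarity c d → Polarity d c → DuallyIsomorphic c d
dual-iso {n} {c} {d} P P′ = F , order , onto
  where
    open Polarity P
    module P′ = Polarity P′
    order : ∀ x y → (x ⊑ y) ⇔ (F y ⊑ F x)
    order x y = mk⇔
      (λ x⊑y → F-greatest x (proj₂ (F y)) (λ i j Fyij xij → F-disjoint y i j Fyij (x⊑y i j xij)))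
      (λ Fy⊑Fx → F-reflects y (proj₂ x) (disjoint-sym (⊆-trans Fy⊑Fx (F-disjoint x))))
    onto : ∀ z → Σ[ x ∈ S n c ] F x ≈ₛ z
    onto z = P′.F z
           , P′.F-reflects z (proj₂ (F (P′.F z))) (F-disjoint (P′.F z))
           , F-greatest (P′.F z) (proj₂ z) (disjoint-sym (P′.F-disjoint z))

iso-dual-selfDual : ∀ {n} {c d : Relation n} → Isomorphic c d → DuallyIsomorphic d c → SelfDual c
iso-dual-selfDual {n} {c} {d} (f , f-order , f-onto) (g , g-order , g-onto) = g ∘ f , order , onto
  where
    order : ∀ x y → (x ⊑ y) ⇔ (g (f y) ⊑ g (f x))
    order x y = mk⇔ (to (g-order (f x) (f y)) ∘ to (f-order x y))
                    (from (f-order x y) ∘ from (g-order (f x) (f y)))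
    onto : ∀ z → Σ[ x ∈ S n c ] g (f x) ≈ₛ z
    onto z with g-onto z
    ... | w , gw⊑z , z⊑gw with f-onto w
    ...   | x , fx⊑w , w⊑fx = x , ⊆-trans (to (g-order w (f x)) w⊑fx) gw⊑z
                                , ⊆-trans z⊑gw (to (g-order (f x) w) fx⊑w)

module AnglePolarity {n : ℕ} (a : Fin n) (W W′ : Subset n) (d≐cᵀ : angle a W′ ≐ angle a W ᵀ) where

  module Orthogonal (X : Relation n) (bipX : IsDecBip X) where
    open IsDecBip bipX

    V : Fin n → Subset n
    V u = subsetOf (λ k → ¬? (decide u k) ×-dec ¬? (k ≟ u))

    ∈V : ∀ {u k} → k ∈ V u ⇔ (¬ X u k × k ≢ u)
    ∈V {u} = ∈-subsetOf (λ k → ¬? (decide u k) ×-dec ¬? (k ≟ u))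

    u∉V : ∀ u → u ∉ V u
    u∉V u u∈V = proj₂ (to ∈V u∈V) refl

    -- if p ∉ V u then p = u or X u p, so X p q would give X u q for q ∈ V u
    cut-disjoint : ∀ u → Disjoint (gRel (V u)) X
    cut-disjoint u p q (p∉V , q∈V) Xpq with p ≟ u
    ... | yes refl = proj₁ (to ∈V q∈V) Xpq
    ... | no  p≢u  = proj₁ (to ∈V q∈V) (transitive Xup Xpq)
      where
        Xup : X u p
        Xup = decidable-stable (decide u p) (λ ¬Xup → p∉V (from ∈V (¬Xup , p≢u)))

    hull : S n (angle a W′)
    hull = ⋁ (λ u → cutS (V u) (u , u∉V u))

    hull-disjoint : Disjoint (proj₁ hull) X
    hull-disjoint = ⋁-least coTransitive
      (λ u → ⊆-trans (proj₁ (cutS-≐ (V u) (u , u∉V u))) (cut-disjoint u))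

    hull-offDiagonal : ∀ {u v} → ¬ X u v → u ≢ v → proj₁ hull u v
    hull-offDiagonal {u} {v} ¬Xuv u≢v =
      ⋁-upper (λ u → cutS (V u) (u , u∉V u)) u u v
        (proj₂ (cutS-≐ (V u) (u , u∉V u)) u v (u∉V u , from ∈V (¬Xuv , u≢v ∘ sym)))

    apexPart : Dec (Disjoint (angle a W′) X) → S n (angle a W′)
    apexPart (yes _) = angle a W′ , genC
    apexPart (no  _) = ⊥S

    apexPart-disjoint : (δ : Dec (Disjoint (angle a W′) X)) → Disjoint (proj₁ (apexPart δ)) X
    apexPart-disjoint (yes d∩X=∅) = d∩X=∅
    apexPart-disjoint (no  _)     = λ _ _ ()

    apexPart-contains : (δ : Dec (Disjoint (angle a W′) X)) → Disjoint (angle a W′) X → angle a W′ ⊆ᵣ proj₁ (apexPart δ)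
    apexPart-contains (yes _)      _     = λ _ _ duv → duv
    apexPart-contains (no  ¬d∩X=∅) d∩X=∅ = ⊥-elim (¬d∩X=∅ d∩X=∅)

    d∩X=∅? : Dec (Disjoint (angle a W′) X)
    d∩X=∅? = disjoint? (IsDecBip.decide (angle-isDecBip a W′)) decide

    orth : S n (angle a W′)
    orth = apexPart d∩X=∅? ∨S hull

    orth-disjoint : Disjoint (proj₁ orth) X
    orth-disjoint = ∨-least coTransitive (apexPart-disjoint d∩X=∅?) hull-disjoint

    orth-offDiagonal : ∀ {u v} → ¬ X u v → u ≢ v → proj₁ orth u v
    orth-offDiagonal ¬Xuv u≢v = ∨-inr _ _ (hull-offDiagonal ¬Xuv u≢v)

    orth-contains-d : Disjoint (angle a W′) X → angle a W′ ⊆ᵣ proj₁ orth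
    orth-contains-d d∩X=∅ = ⊆-trans (apexPart-contains d∩X=∅? d∩X=∅) ∨-inl

  bipW : IsDecBip (angle a W)
  bipW = angle-isDecBip a W

  orthogonal : S n (angle a W) → S n (angle a W′)
  orthogonal (X , X∈) = Orthogonal.orth X (InS-isDecBip bipW X∈)

  orthogonal-disjoint : ∀ x → Disjoint (proj₁ (orthogonal x)) (proj₁ x)
  orthogonal-disjoint (X , X∈) = Orthogonal.orth-disjoint X (InS-isDecBip bipW X∈)

  -- every element of S(n,⟨a,W′⟩) avoiding x lies below the orthogonal of x:
  -- its cuts are off-diagonal and ⟨a,W′⟩ itself is included when it avoids x
  orthogonal-greatest : ∀ x {Z} → InS (angle a W′) Z → Disjoint Z (proj₁ x) → Z ⊆ᵣ proj₁ (orthogonal x)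
  orthogonal-greatest (X , X∈) = greatest
    where
      open Orthogonal X (InS-isDecBip bipW X∈)
      greatest : ∀ {Z} → InS (angle a W′) Z → Disjoint Z X → Z ⊆ᵣ proj₁ orth
      greatest bot          _    _ _ ()
      greatest (genG V _ _) disj u v g = orth-offDiagonal (disj u v g) (cut-irreflexive V g)
      greatest genC         disj = orth-contains-d disj
      greatest (join p q)   disj =
        ∨-least _++_ (greatest p (⊆-trans ∨-inl disj)) (greatest q (⊆-trans ∨-inr disj))

  orthogonal-reflects : ∀ y {G} → InS (angle a W) G → Disjoint G (proj₁ (orthogonal y)) → G ⊆ᵣ proj₁ y
  orthogonal-reflects (Y , Y∈) = reflects
    where
      bipY = InS-isDecBip bipW Y∈
      open IsDecBip bipY
      open Orthogonal Y bipY

      inY : ∀ {G u v} → Disjoint G (proj₁ orth) → G u v → u ≢ v → Y u v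
      inY disj g u≢v = decidable-stable (decide _ _) (λ ¬Y → disj _ _ g (orth-offDiagonal ¬Y u≢v))

      loopAt-a : ∀ {u v} → a ≡ u ⊎ Y a u → Y u v → v ≡ a ⊎ Y v a → Y a a
      loopAt-a (inj₁ refl) Yuv (inj₁ refl) = Yuv
      loopAt-a (inj₁ refl) Yuv (inj₂ Yva)  = transitive Yuv Yva
      loopAt-a (inj₂ Yau)  Yuv (inj₁ refl) = transitive Yau Yuv
      loopAt-a (inj₂ Yau)  Yuv (inj₂ Yva)  = transitive (transitive Yau Yuv) Yva

      -- if Y contains the off-diagonal part of ⟨a,W⟩ but not (a,a), then ⟨a,W′⟩ avoids Y:
      -- a pair (u,v) of ⟨a,W′⟩ gives a path a ⟶ u ⟶ v ⟶ a in ⟨a,W⟩ ∪ Y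
      apex-avoids : (∀ {u v} → angle a W u v → u ≢ v → Y u v) → ¬ Y a a → Disjoint (angle a W′) Y
      apex-avoids offY ¬Yaa u v duv Yuv =
        ¬Yaa (loopAt-a (step (proj₂ hub)) Yuv (step (proj₁ hub)))
        where
          hub = angle-hub W (proj₁ d≐cᵀ u v duv)
          step : ∀ {p q} → angle a W p q → p ≡ q ⊎ Y p q
          step {p} {q} cpq with p ≟ q
          ... | yes p≡q = inj₁ p≡q
          ... | no  p≢q = inj₂ (offY cpq p≢q)

      reflects : ∀ {G} → InS (angle a W) G → Disjoint G (proj₁ orth) → G ⊆ᵣ Y
      reflects bot          _    _ _ ()
      reflects (genG V _ _) disj u v g = inY disj g (cut-irreflexive V g)
      reflects genC         disj u v g with u ≟ v
      ... | no  u≢v  = inY disj g u≢v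
      ... | yes refl = subst (λ w → Y w w) (sym (angle-loop W g)) Yaa
        where
          Yaa : Y a a
          Yaa = decidable-stable (decide a a) λ ¬Yaa →
            disj a a (angle-apex W) (orth-contains-d (apex-avoids (inY disj) ¬Yaa) a a (angle-apex W′))
      reflects (join p q)   disj =
        ∨-least transitive (reflects p (⊆-trans ∨-inl disj)) (reflects q (⊆-trans ∨-inr disj))

  polarity : Polarity (angle a W) (angle a W′)
  polarity = record
    { F          = orthogonal
    ; F-disjoint = orthogonal-disjoint
    ; F-greatest = orthogonal-greatest
    ; F-reflects = orthogonal-reflects
    }

proposition9p6 : (n : ℕ) → 0 < n → (a : Fin n) → (U : Subset n) →
    Isomorphic (angle a U) (angle a (∁ U)) ×
    DuallyIsomorphic (angle a U) (angle a (∁ U)) ×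
    SelfDual (angle a U)
proposition9p6 n _ a U = iso , dual , iso-dual-selfDual iso dual′
  where
    ∁U≐Uᵀ : angle a (∁ U) ≐ angle a U ᵀ
    ∁U≐Uᵀ = angle-ᵀ a U

    iso : Isomorphic (angle a U) (angle a (∁ U))
    iso = transpose-iso ∁U≐Uᵀ

    forward : Polarity (angle a U) (angle a (∁ U))
    forward = AnglePolarity.polarity a U (∁ U) ∁U≐Uᵀ

    backward : Polarity (angle a (∁ U)) (angle a U)
    backward = AnglePolarity.polarity a (∁ U) U (ᵀ-swap ∁U≐Uᵀ)

    dual : DuallyIsomorphic (angle a U) (angle a (∁ U))
    dual = dual-iso forward backward

    dual′ : DuallyIsomorphic (angle a (∁ U)) (angle a U)
    dual′ = dual-iso backward forward
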